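{- For every integer $n\ge 1$, $\mathrm{BQP}_n\le_A \mathrm{QAP}_{2n}$.
   Context: The Boolean quadratic polytope $\mathrm{BQP}_n$ is the convex hull of the set of vectors $x=(x_{ij})_{1\le i\le j\le n}\in\{0,1\}^{n(n+1)/2}$ satisfying $x_{ij}=x_{ii}x_{jj}$ for all $1\le i<j\le n$. For $m\ge1$, the quadratic assignment polytope $\mathrm{QAP}_m$ is the convex hull of all $0/1$ vectors $(y,z)$, with $y=(y_{ij})_{i,j\in[m]}$ and $z=(z_{ijkl})$ indexed by pairs of pairs $(i,j)\prec(k,l)$ in $[m]\times[m]$ (where $\prec$ is the lexicographic order: $i<k$, or $i=k$ and $j<l$), such that $\sum_j y_{ij}=1$ for all $i\in[m]$, $\sum_i y_{ij}=1$ for all $j\in[m]$, and $z_{ijkl}=y_{ij}y_{kl}$ for all $(i,j)\prec(k,l)$. For polytopes $p,q$, $p\le_A q$ means that $p$ is affinely equivalent (there is an affine bijection between their affine hulls mapping one onto the other) to $q$ or to a face of $q$.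
   Formalization: The polytopes $\mathrm{BQP}_n$ and $\mathrm{QAP}_{2n}$, their affine hulls, the affine bijection and the affine functional cutting out the face are all taken over the rationals. -}

module Defs where

open import Level using (Level)
open import Data.Nat as ℕ using (ℕ; zero; suc; _≤ᵇ_; _<ᵇ_; _≡ᵇ_)
open import Data.Nat.Properties using (≤⇒≤ᵇ; ≤-refl)
open import Data.Fin using (Fin; toℕ; zero; suc)
open import Data.Rational using (ℚ; 0ℚ; 1ℚ; _+_; _*_; _-_; _≤_)
open import Data.Product using (Σ; _×_; _,_; proj₁; proj₂)
open import Data.Sum using (_⊎_; inj₁; inj₂)
open import Data.Bool using (Bool; T; _∧_; _∨_)
open import Relation.Binary.PropositionalEquality using (_≡_)

Pt : Set → Set
Pt I = I → ℚ

_≈_ : {I : Set} → Pt I → Pt I → Set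
x ≈ y = ∀ i → x i ≡ y i

Region : Set → Set₁
Region I = Pt I → Set

∑ : {k : ℕ} → (Fin k → ℚ) → ℚ
∑ {zero}  f = 0ℚ
∑ {suc k} f = f zero + ∑ (λ a → f (suc a))

conv : {I : Set} → Region I → Region I
conv {I} S x = Σ ℕ λ k → Σ (Fin k → Pt I) λ p → Σ (Fin k → ℚ) λ w →
  (∀ a → S (p a)) × (∀ a → 0ℚ ≤ w a) × (∑ w ≡ 1ℚ) ×
  (∀ i → x i ≡ ∑ (λ a → w a * p a i))

aff : {I : Set} → Region I → Region I
aff {I} S x = Σ ℕ λ k → Σ (Fin k → Pt I) λ p → Σ (Fin k → ℚ) λ w →
  (∀ a → S (p a)) × (∑ w ≡ 1ℚ) ×
  (∀ i → x i ≡ ∑ (λ a → w a * p a i))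

comb : {I : Set} → ℚ → Pt I → Pt I → Pt I
comb t x y i = t * x i + (1ℚ - t) * y i

-- Affine equivalence: an affine bijection f : aff P → aff Q with f(P) = Q.
-- f is given as a function on all of ℚ^I but only its behaviour on aff P
-- is constrained (i.e. it is a map on the affine hull).

record AffinelyEquivalent {I J : Set} (P : Region I) (Q : Region J) : Set where
  field
    f          : Pt I → Pt J
    f-cong     : ∀ {x y} → aff P x → aff P y → x ≈ y → f x ≈ f y
    f-affine   : ∀ {x y} (t : ℚ) → aff P x → aff P y →
                 f (comb t x y) ≈ comb t (f x) (f y)
    f-into     : ∀ {x} → aff P x → aff Q (f x)
    f-injective  : ∀ {x y} → aff P x → aff P y → f x ≈ f y → x ≈ y
    f-surjective : ∀ {y} → aff Q y → Σ (Pt I) λ x → aff P x × (f x ≈ y)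
    f-maps     : ∀ {x} → P x → Q (f x)
    f-onto     : ∀ {y} → Q y → Σ (Pt I) λ x → P x × (f x ≈ y)

record IsAffineFunctional {J : Set} (g : Pt J → ℚ) : Set where
  field
    g-cong   : ∀ {x y} → x ≈ y → g x ≡ g y
    g-affine : ∀ (t : ℚ) x y → g (comb t x y) ≡ t * g x + (1ℚ - t) * g y

IsFace : {J : Set} → Region J → Region J → Set
IsFace {J} F Q = Σ (Pt J → ℚ) λ g → IsAffineFunctional g ×
  (∀ y → Q y → g y ≤ 0ℚ) ×
  (∀ y → F y → Q y × (g y ≡ 0ℚ)) × (∀ y → Q y → g y ≡ 0ℚ → F y)

_≤A_ : {I J : Set} → Region I → Region J → Set₁
_≤A_ {I} {J} P Q = AffinelyEquivalent P Q ⊎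
  Σ (Region J) λ F → IsFace F Q × AffinelyEquivalent P F

BQPIdx : ℕ → Set
BQPIdx n = Σ (Fin n × Fin n) λ ij → T (toℕ (proj₁ ij) ≤ᵇ toℕ (proj₂ ij))

diag : {n : ℕ} → Fin n → BQPIdx n
diag i = (i , i) , ≤⇒≤ᵇ (≤-refl {toℕ i})

Is01 : ℚ → Set
Is01 q = (q ≡ 0ℚ) ⊎ (q ≡ 1ℚ)

BQPVert : (n : ℕ) → Region (BQPIdx n)
BQPVert n x =
  (∀ k → Is01 (x k)) ×
  (∀ (k : BQPIdx n) → toℕ (proj₁ (proj₁ k)) ℕ.< toℕ (proj₂ (proj₁ k)) →
     x k ≡ x (diag (proj₁ (proj₁ k))) * x (diag (proj₂ (proj₁ k))))

BQP : (n : ℕ) → Region (BQPIdx n)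
BQP n = conv (BQPVert n)

lexLt : {m : ℕ} → Fin m × Fin m → Fin m × Fin m → Bool
lexLt (i , j) (k , l) = (toℕ i <ᵇ toℕ k) ∨ ((toℕ i ≡ᵇ toℕ k) ∧ (toℕ j <ᵇ toℕ l))

QAPIdx : ℕ → Set
QAPIdx m = (Fin m × Fin m) ⊎
  Σ ((Fin m × Fin m) × (Fin m × Fin m)) λ pq → T (lexLt (proj₁ pq) (proj₂ pq))

QAPVert : (m : ℕ) → Region (QAPIdx m)
QAPVert m v =
  (∀ c → Is01 (v c)) ×
  (∀ i → ∑ (λ j → y i j) ≡ 1ℚ) ×
  (∀ j → ∑ (λ i → y i j) ≡ 1ℚ) ×
  (∀ i j k l (p : T (lexLt (i , j) (k , l))) →
     v (inj₂ (((i , j) , (k , l)) , p)) ≡ y i j * y k l)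
  where
    y : Fin m → Fin m → ℚ
    y i j = v (inj₁ (i , j))

QAP : (m : ℕ) → Region (QAPIdx m)
QAP m = conv (QAPVert m)

-- Split [2n] into n blocks {(0,b), (1,b)}. A vertex x of BQP_n, with diagonal s_b = x_bb, is sent to
-- the permutation that swaps block b exactly when s_b = 1, so every entry y_ij is one of 0, s_b and
-- 1 - s_b, and every product z = y_ij y_kl is affine in x because s_b s_b' = x_bb' on vertices.
-- The image is the face of QAP_2n on which all entries outside the diagonal blocks vanish. Reading off
-- x_bb = y_(0,b)(1,b) and x_bb' = z_((0,b),(1,b)),((0,b'),(1,b')) inverts the map, since a 2×2 doubly
-- stochastic block is determined by one entry; vertices carrying positive weight in a point of a face
-- lie in the face, so the inverse extends from vertices to the whole face.
module Submission where

open import Data.Bool using (T)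
open import Data.Bool.Properties using (T-∨; T-irrelevant)
open import Data.Fin using (Fin; zero; suc; toℕ; combine; remQuot; _↑ˡ_; _↑ʳ_)
open import Data.Fin.Properties
  using (_≟_; suc-injective; toℕ-injective; toℕ-↑ˡ; remQuot-combine; combine-remQuot)
import Data.Nat as ℕ
open import Data.Nat using (ℕ)
open import Data.Nat.Properties using (≤⇒≤ᵇ; ≤ᵇ⇒≤; <⇒<ᵇ; <⇒≤; ≰⇒>; ≮⇒≥; <-irrefl)
import Data.Nat.Properties as ℕP
open import Data.Product using (Σ; _×_; _,_; proj₁; proj₂; uncurry)
open import Data.Rational using (ℚ; 0ℚ; 1ℚ; _+_; _*_; _-_; -_; _≤_)
import Data.Rational.Properties as ℚP
open import Data.Rational.Solver using (module +-*-Solver)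
open import Data.Sum using (inj₁; inj₂)
open import Data.Vec.Functional using ([]; _∷_)
open import Function using (_∘_; Equivalence)
open import Relation.Binary.PropositionalEquality
  using (_≡_; _≢_; refl; sym; trans; cong; cong₂; subst; subst₂; module ≡-Reasoning)
open import Relation.Nullary using (yes; no; contradiction)

open import Defs

open +-*-Solver
open ≡-Reasoning

∑-cong : ∀ {k} {f g : Fin k → ℚ} → (∀ a → f a ≡ g a) → ∑ f ≡ ∑ g
∑-cong {ℕ.zero}  f≗g = refl
∑-cong {ℕ.suc k} f≗g = cong₂ _+_ (f≗g zero) (∑-cong (f≗g ∘ suc))

∑-zero : ∀ k → ∑ {k} (λ _ → 0ℚ) ≡ 0ℚ
∑-zero ℕ.zero    = refl
∑-zero (ℕ.suc k) = trans (ℚP.+-identityˡ _) (∑-zero k)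

∑-distrib-+ : ∀ {k} (f g : Fin k → ℚ) → ∑ (λ a → f a + g a) ≡ ∑ f + ∑ g
∑-distrib-+ {ℕ.zero}  f g = refl
∑-distrib-+ {ℕ.suc k} f g =
  trans (cong (f zero + g zero +_) (∑-distrib-+ (f ∘ suc) (g ∘ suc)))
        (solve 4 (λ a b c d → (a :+ b) :+ (c :+ d) := (a :+ c) :+ (b :+ d))
               refl (f zero) (g zero) (∑ (f ∘ suc)) (∑ (g ∘ suc)))

*-distribˡ-∑ : ∀ {k} c (f : Fin k → ℚ) → c * ∑ f ≡ ∑ (λ a → c * f a)
*-distribˡ-∑ {ℕ.zero}  c f = ℚP.*-zeroʳ c
*-distribˡ-∑ {ℕ.suc k} c f =
  trans (ℚP.*-distribˡ-+ c (f zero) _) (cong (c * f zero +_) (*-distribˡ-∑ c (f ∘ suc)))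

∑-comb : ∀ {k} t (f g : Fin k → ℚ) →
         ∑ (λ a → t * f a + (1ℚ - t) * g a) ≡ t * ∑ f + (1ℚ - t) * ∑ g
∑-comb {k} t f g = trans (∑-distrib-+ {k} _ _)
                     (sym (cong₂ _+_ (*-distribˡ-∑ t f) (*-distribˡ-∑ (1ℚ - t) g)))

∑-nonneg : ∀ {k} {f : Fin k → ℚ} → (∀ a → 0ℚ ≤ f a) → 0ℚ ≤ ∑ f
∑-nonneg {ℕ.zero}  f≥0 = ℚP.≤-refl
∑-nonneg {ℕ.suc k} f≥0 = ℚP.+-mono-≤ (f≥0 zero) (∑-nonneg (f≥0 ∘ suc))

nonneg-+≡0ˡ : ∀ {p q} → 0ℚ ≤ p → 0ℚ ≤ q → p + q ≡ 0ℚ → p ≡ 0ℚ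
nonneg-+≡0ˡ {p} {q} p≥0 q≥0 p+q≡0 = ℚP.≤-antisym p≤0 p≥0
  where
  p≤0 : p ≤ 0ℚ
  p≤0 = subst₂ _≤_ (ℚP.+-identityʳ p) p+q≡0 (ℚP.+-monoʳ-≤ p q≥0)

∑-nonneg-zero : ∀ {k} {f : Fin k → ℚ} → (∀ a → 0ℚ ≤ f a) → ∑ f ≡ 0ℚ → ∀ a → f a ≡ 0ℚ
∑-nonneg-zero {ℕ.suc k} f≥0 ∑f≡0 zero    = nonneg-+≡0ˡ (f≥0 zero) (∑-nonneg (f≥0 ∘ suc)) ∑f≡0
∑-nonneg-zero {ℕ.suc k} {f} f≥0 ∑f≡0 (suc a) = ∑-nonneg-zero (f≥0 ∘ suc) ∑tail≡0 a
  where
  ∑tail≡0 : ∑ (f ∘ suc) ≡ 0ℚ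
  ∑tail≡0 = nonneg-+≡0ˡ (∑-nonneg (f≥0 ∘ suc)) (f≥0 zero)
                        (trans (ℚP.+-comm _ (f zero)) ∑f≡0)

∑-single : ∀ {k} (f : Fin k → ℚ) b → (∀ c → c ≢ b → f c ≡ 0ℚ) → ∑ f ≡ f b
∑-single {ℕ.suc k} f zero f-off =
  trans (cong (f zero +_) (trans (∑-cong (λ c → f-off (suc c) λ ())) (∑-zero k)))
        (ℚP.+-identityʳ (f zero))
∑-single {ℕ.suc k} f (suc b) f-off =
  trans (cong (_+ ∑ (f ∘ suc)) (f-off zero λ ()))
        (trans (ℚP.+-identityˡ _)
               (∑-single (f ∘ suc) b (λ c c≢b → f-off (suc c) (c≢b ∘ suc-injective))))

∑-↑ : ∀ k l (f : Fin (k ℕ.+ l) → ℚ) → ∑ f ≡ ∑ (λ a → f (a ↑ˡ l)) + ∑ (λ b → f (k ↑ʳ b))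
∑-↑ ℕ.zero    l f = sym (ℚP.+-identityˡ _)
∑-↑ (ℕ.suc k) l f =
  trans (cong (f zero +_) (∑-↑ k l (f ∘ suc))) (sym (ℚP.+-assoc (f zero) _ _))

∑-combine : ∀ k l (f : Fin (k ℕ.* l) → ℚ) → ∑ f ≡ ∑ (λ s → ∑ (λ b → f (combine {k} {l} s b)))
∑-combine ℕ.zero    l f = refl
∑-combine (ℕ.suc k) l f =
  trans (∑-↑ l (k ℕ.* l) f) (cong (∑ (f ∘ combine {ℕ.suc k} zero) +_) (∑-combine k l (f ∘ (l ↑ʳ_))))

∑-combine-single : ∀ {k l} (f : Fin (k ℕ.* l) → ℚ) b →
                   (∀ s c → c ≢ b → f (combine {k} {l} s c) ≡ 0ℚ) →
                   ∑ f ≡ ∑ (λ s → f (combine {k} {l} s b))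
∑-combine-single {k} {l} f b f-off =
  trans (∑-combine k l f) (∑-cong (λ s → ∑-single (f ∘ combine {k} {l} s) b (f-off s)))

∑-weighted-cong : ∀ {k} (w u v : Fin k → ℚ) → (∀ a → w a ≢ 0ℚ → u a ≡ v a) →
                  ∑ (λ a → w a * u a) ≡ ∑ (λ a → w a * v a)
∑-weighted-cong w u v u≡v = ∑-cong term
  where
  term : ∀ a → w a * u a ≡ w a * v a
  term a with w a ℚP.≟ 0ℚ
  ... | yes wa≡0 rewrite wa≡0 = trans (ℚP.*-zeroˡ (u a)) (sym (ℚP.*-zeroˡ (v a)))
  ... | no  wa≢0 = cong (w a *_) (u≡v a wa≢0)

combine-elim : ∀ {k l} (P : Fin (k ℕ.* l) → Set) → (∀ s b → P (combine {k} {l} s b)) → ∀ i → P i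
combine-elim {k} {l} P P-combine i =
  subst P (combine-remQuot {k} l i) (uncurry P-combine (remQuot l i))

Is01-* : ∀ {p q} → Is01 p → Is01 q → Is01 (p * q)
Is01-* {q = q} (inj₁ refl) _  = inj₁ (ℚP.*-zeroˡ q)
Is01-* {q = q} (inj₂ refl) q∈ = subst Is01 (sym (ℚP.*-identityˡ q)) q∈

Is01-idem : ∀ {p} → Is01 p → p * p ≡ p
Is01-idem (inj₁ refl) = refl
Is01-idem (inj₂ refl) = refl

Is01-nonneg-* : ∀ {w p} → 0ℚ ≤ w → Is01 p → 0ℚ ≤ w * p
Is01-nonneg-* {w} w≥0 (inj₁ refl) = subst (0ℚ ≤_) (sym (ℚP.*-zeroʳ w)) ℚP.≤-refl
Is01-nonneg-* {w} w≥0 (inj₂ refl) = subst (0ℚ ≤_) (sym (ℚP.*-identityʳ w)) w≥0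

Is01-*-cancelˡ : ∀ {w p} → w ≢ 0ℚ → Is01 p → w * p ≡ 0ℚ → p ≡ 0ℚ
Is01-*-cancelˡ     w≢0 (inj₁ p≡0) _     = p≡0
Is01-*-cancelˡ {w} w≢0 (inj₂ refl) w1≡0 = contradiction (trans (sym (ℚP.*-identityʳ w)) w1≡0) w≢0

conv-01-nonneg : ∀ {I} {S : Region I} → (∀ {y} → S y → ∀ i → Is01 (y i)) →
                 ∀ {x} → conv S x → ∀ i → 0ℚ ≤ x i
conv-01-nonneg S⊆01 (_ , p , w , p∈S , w≥0 , _ , x≡) i =
  subst (0ℚ ≤_) (sym (x≡ i)) (∑-nonneg (λ a → Is01-nonneg-* (w≥0 a) (S⊆01 (p∈S a) i)))

-- Lines σ ↦ c σ + a, given as (slope , intercept)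

Line : Set
Line = ℚ × ℚ

_⟨$⟩_ : Line → ℚ → ℚ
(c , a) ⟨$⟩ σ = c * σ + a

identityLine : ∀ σ → (1ℚ , 0ℚ) ⟨$⟩ σ ≡ σ
identityLine = solve 1 (λ σ → con 1ℚ :* σ :+ con 0ℚ := σ) refl

zeroLine : ∀ σ → (0ℚ , 0ℚ) ⟨$⟩ σ ≡ 0ℚ
zeroLine = solve 1 (λ σ → con 0ℚ :* σ :+ con 0ℚ := con 0ℚ) refl

complementLine-01 : ∀ {σ} → Is01 σ → Is01 ((- 1ℚ , 1ℚ) ⟨$⟩ σ)
complementLine-01 (inj₁ refl) = inj₂ refl
complementLine-01 (inj₂ refl) = inj₁ refl

PreservesAffineCombinations : {I J : Set} → (Pt I → Pt J) → Set
PreservesAffineCombinations {I} φ =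
  ∀ {k x} (p : Fin k → Pt I) (w : Fin k → ℚ) → ∑ w ≡ 1ℚ →
  (∀ i → x i ≡ ∑ (λ a → w a * p a i)) → ∀ j → φ x j ≡ ∑ (λ a → w a * φ (p a) j)

module _ {I J : Set} {φ : Pt I → Pt J} (φ-preserves : PreservesAffineCombinations φ) where

  preserves-cong : ∀ {x y} → x ≈ y → φ x ≈ φ y
  preserves-cong {x} {y} x≈y j =
    trans (φ-preserves (y ∷ []) (1ℚ ∷ []) (ℚP.+-identityʳ 1ℚ)
                       (λ i → trans (x≈y i) (sym (identityLine (y i)))) j)
          (identityLine (φ y j))

  preserves-comb : ∀ t x y → φ (comb t x y) ≈ comb t (φ x) (φ y)
  preserves-comb t x y j =
    trans (φ-preserves (x ∷ y ∷ []) (t ∷ (1ℚ - t) ∷ []) weights-sum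
                       (λ i → cong (t * x i +_) (sym (ℚP.+-identityʳ _))) j)
          (cong (t * φ x j +_) (ℚP.+-identityʳ _))
    where
    weights-sum : t + ((1ℚ - t) + 0ℚ) ≡ 1ℚ
    weights-sum = solve 1 (λ t → t :+ ((con 1ℚ :- t) :+ con 0ℚ) := con 1ℚ) refl t

  conv-image : {S : Region I} {S′ : Region J} → (∀ {x} → S x → S′ (φ x)) →
               ∀ {x} → conv S x → conv S′ (φ x)
  conv-image φ[S]⊆S′ (k , p , w , p∈S , w≥0 , ∑w≡1 , x≡) =
    k , φ ∘ p , w , φ[S]⊆S′ ∘ p∈S , w≥0 , ∑w≡1 , φ-preserves p w ∑w≡1 x≡

  aff-image : {S : Region I} {S′ : Region J} → (∀ {x} → S x → S′ (φ x)) →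
              ∀ {x} → aff S x → aff S′ (φ x)
  aff-image φ[S]⊆S′ (k , p , w , p∈S , ∑w≡1 , x≡) =
    k , φ ∘ p , w , φ[S]⊆S′ ∘ p∈S , ∑w≡1 , φ-preserves p w ∑w≡1 x≡

∘-preserves : ∀ {I J K} {φ : Pt J → Pt K} {ψ : Pt I → Pt J} →
              PreservesAffineCombinations φ → PreservesAffineCombinations ψ →
              PreservesAffineCombinations (φ ∘ ψ)
∘-preserves {ψ = ψ} φ-preserves ψ-preserves p w ∑w≡1 x≡ =
  φ-preserves (ψ ∘ p) w ∑w≡1 (ψ-preserves p w ∑w≡1 x≡)

fixes-combination : ∀ {I} {θ : Pt I → Pt I} → PreservesAffineCombinations θ →
                    ∀ {k x} (p : Fin k → Pt I) (w : Fin k → ℚ) → ∑ w ≡ 1ℚ →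
                    (∀ i → x i ≡ ∑ (λ a → w a * p a i)) →
                    (∀ a → w a ≢ 0ℚ → θ (p a) ≈ p a) → θ x ≈ x
fixes-combination {θ = θ} θ-preserves {x = x} p w ∑w≡1 x≡ fixed i = begin
  θ x i                          ≡⟨ θ-preserves p w ∑w≡1 x≡ i ⟩
  ∑ (λ a → w a * θ (p a) i)      ≡⟨ ∑-weighted-cong w _ _ (λ a wa≢0 → fixed a wa≢0 i) ⟩
  ∑ (λ a → w a * p a i)          ≡⟨ sym (x≡ i) ⟩
  x i                            ∎

mkAffinelyEquivalent : ∀ {I J} {P : Region I} {Q : Region J} {φ : Pt I → Pt J} {ψ : Pt J → Pt I} →
                       PreservesAffineCombinations φ → PreservesAffineCombinations ψ →
                       (∀ {x} → P x → Q (φ x)) → (∀ {y} → Q y → P (ψ y)) →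
                       (∀ x → ψ (φ x) ≈ x) → (∀ {y} → Q y → φ (ψ y) ≈ y) →
                       AffinelyEquivalent P Q
mkAffinelyEquivalent {P = P} {Q} {φ} {ψ} φ-preserves ψ-preserves φ[P]⊆Q ψ[Q]⊆P ψφ≈id φψ≈id = record
  { f            = φ
  ; f-cong       = λ _ _ → preserves-cong φ-preserves
  ; f-affine     = λ t _ _ → preserves-comb φ-preserves t _ _
  ; f-into       = aff-image φ-preserves {S = P} {S′ = Q} φ[P]⊆Q
  ; f-injective  = injective
  ; f-surjective = surjective
  ; f-maps       = φ[P]⊆Q
  ; f-onto       = λ y∈Q → ψ _ , ψ[Q]⊆P y∈Q , φψ≈id y∈Q
  }
  where
  injective : ∀ {x y} → aff P x → aff P y → φ x ≈ φ y → x ≈ y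
  injective {x} {y} _ _ φx≈φy i =
    trans (sym (ψφ≈id x i)) (trans (preserves-cong ψ-preserves φx≈φy i) (ψφ≈id y i))

  surjective : ∀ {y} → aff Q y → Σ (Pt _) λ x → aff P x × (φ x ≈ y)
  surjective y∈affQ@(_ , q , w , q∈Q , ∑w≡1 , y≡) =
    ψ _ , aff-image ψ-preserves {S = Q} {S′ = P} ψ[Q]⊆P y∈affQ ,
    fixes-combination (∘-preserves φ-preserves ψ-preserves) q w ∑w≡1 y≡ (λ a _ → φψ≈id (q∈Q a))

face-of-valid-inequality : ∀ {J} {Q : Region J} {g : Pt J → ℚ} → IsAffineFunctional g →
                           (∀ y → Q y → g y ≤ 0ℚ) → IsFace (λ y → Q y × (g y ≡ 0ℚ)) Q
face-of-valid-inequality {g = g} g-affine g≤0 = g , g-affine , g≤0 , (λ _ y∈F → y∈F) , (λ _ → _,_)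

-- Affine forms q₁ x_i₁ + ⋯ + q_r x_iᵣ + c

data Form (I : Set) : Set where
  con : ℚ → Form I
  lin : ℚ → I → Form I → Form I

eval : ∀ {I} → Pt I → Form I → ℚ
eval x (con c)     = c
eval x (lin q i F) = q * x i + eval x F

eval-combination : ∀ {I k x} (p : Fin k → Pt I) (w : Fin k → ℚ) → ∑ w ≡ 1ℚ →
                   (∀ i → x i ≡ ∑ (λ a → w a * p a i)) →
                   ∀ F → eval x F ≡ ∑ (λ a → w a * eval (p a) F)
eval-combination p w ∑w≡1 x≡ (con c) = begin
  c                      ≡⟨ solve 1 (λ c → c := c :* con 1ℚ) refl c ⟩
  c * 1ℚ                 ≡⟨ cong (c *_) (sym ∑w≡1) ⟩
  c * ∑ w                ≡⟨ *-distribˡ-∑ c w ⟩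
  ∑ (λ a → c * w a)      ≡⟨ ∑-cong (λ a → ℚP.*-comm c (w a)) ⟩
  ∑ (λ a → w a * c)      ∎
eval-combination {k = k} {x = x} p w ∑w≡1 x≡ (lin q i F) = begin
  q * x i + eval x F
    ≡⟨ cong₂ (λ u v → q * u + v) (x≡ i) (eval-combination p w ∑w≡1 x≡ F) ⟩
  q * ∑ (λ a → w a * p a i) + ∑ (λ a → w a * eval (p a) F)
    ≡⟨ cong (_+ _) (*-distribˡ-∑ {k} q _) ⟩
  ∑ (λ a → q * (w a * p a i)) + ∑ (λ a → w a * eval (p a) F)
    ≡⟨ sym (∑-distrib-+ {k} _ _) ⟩
  ∑ (λ a → q * (w a * p a i) + w a * eval (p a) F)
    ≡⟨ ∑-cong (λ a → solve 4 (λ q w u v → q :* (w :* u) :+ w :* v := w :* (q :* u :+ v))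
                              refl q (w a) (p a i) (eval (p a) F)) ⟩
  ∑ (λ a → w a * (q * p a i + eval (p a) F))
    ∎

evalMap : ∀ {I J} → (J → Form I) → Pt I → Pt J
evalMap F x j = eval x (F j)

evalMap-preserves : ∀ {I J} (F : J → Form I) → PreservesAffineCombinations (evalMap F)
evalMap-preserves F p w ∑w≡1 x≡ j = eval-combination p w ∑w≡1 x≡ (F j)

lineForm : ∀ {I} → Line → I → Form I
lineForm (c , a) i = lin c i (con a)

bqpIdx-irrelevant : ∀ {n} {b b′ : Fin n} (p q : T (toℕ b ℕ.≤ᵇ toℕ b′)) →
                    _≡_ {A = BQPIdx n} ((b , b′) , p) ((b , b′) , q)
bqpIdx-irrelevant p q = cong (_ ,_) (T-irrelevant p q)

pairIdx : ∀ {n} → Fin n → Fin n → BQPIdx n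
pairIdx b b′ with toℕ b ℕ.≤? toℕ b′
... | yes b≤b′ = (b , b′) , ≤⇒≤ᵇ b≤b′
... | no  b≰b′ = (b′ , b) , ≤⇒≤ᵇ (<⇒≤ (≰⇒> b≰b′))

pairIdx-≤ : ∀ {n} {b b′ : Fin n} (p : T (toℕ b ℕ.≤ᵇ toℕ b′)) → pairIdx b b′ ≡ ((b , b′) , p)
pairIdx-≤ {b = b} {b′} p with toℕ b ℕ.≤? toℕ b′
... | yes _    = bqpIdx-irrelevant _ _
... | no b≰b′ = contradiction (≤ᵇ⇒≤ _ _ p) b≰b′

pairIdx-vertex : ∀ {n x} → BQPVert n x → ∀ b b′ → x (pairIdx b b′) ≡ x (diag b) * x (diag b′)
pairIdx-vertex {x = x} (x∈01 , x≡) b b′ with toℕ b ℕ.≤? toℕ b′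
... | no b≰b′ = trans (x≡ ((b′ , b) , _) (≰⇒> b≰b′)) (ℚP.*-comm (x (diag b′)) (x (diag b)))
... | yes b≤b′ with toℕ b ℕ.<? toℕ b′
...   | yes b<b′ = x≡ ((b , b′) , _) b<b′
...   | no b≮b′ with toℕ-injective (ℕP.≤-antisym b≤b′ (≮⇒≥ b≮b′))
...     | refl = trans (cong x (bqpIdx-irrelevant _ _)) (sym (Is01-idem (x∈01 (diag b))))

productForm : ∀ {n} → Line → Fin n → Line → Fin n → Form (BQPIdx n)
productForm (c , a) b (c′ , a′) b′ =
  lin (c * c′) (pairIdx b b′) (lin (c * a′) (diag b) (lin (a * c′) (diag b′) (con (a * a′))))

eval-productForm : ∀ {n x} → BQPVert n x → ∀ κ b κ′ b′ →
                   eval x (productForm κ b κ′ b′) ≡ (κ ⟨$⟩ x (diag b)) * (κ′ ⟨$⟩ x (diag b′))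
eval-productForm {x = x} x∈V (c , a) b (c′ , a′) b′ =
  trans (cong (λ u → c * c′ * u + (c * a′ * x (diag b) + (a * c′ * x (diag b′) + a * a′)))
              (pairIdx-vertex x∈V b b′))
        (solve 6 (λ c a c′ a′ σ σ′ →
                    c :* c′ :* (σ :* σ′) :+ (c :* a′ :* σ :+ (a :* c′ :* σ′ :+ a :* a′))
                    := (c :* σ :+ a) :* (c′ :* σ′ :+ a′))
               refl c a c′ a′ (x (diag b)) (x (diag b′)))

eval-productForm-identity : ∀ {n} x (b b′ : Fin n) →
                            eval x (productForm (1ℚ , 0ℚ) b (1ℚ , 0ℚ) b′) ≡ x (pairIdx b b′)
eval-productForm-identity x b b′ =
  solve 3 (λ z σ σ′ → con 1ℚ :* con 1ℚ :* z :+ (con 1ℚ :* con 0ℚ :* σ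
                       :+ (con 0ℚ :* con 1ℚ :* σ′ :+ con 0ℚ :* con 0ℚ)) := z)
        refl (x (pairIdx b b′)) (x (diag b)) (x (diag b′))

-- Entries of a 2 × 2 permutation matrix [[1 - σ, σ], [σ, 1 - σ]] as lines in σ

swapLine : Fin 2 → Fin 2 → Line
swapLine zero    zero    = - 1ℚ , 1ℚ
swapLine zero    (suc _) = 1ℚ , 0ℚ
swapLine (suc _) zero    = 1ℚ , 0ℚ
swapLine (suc _) (suc _) = - 1ℚ , 1ℚ

swapLine-sym : ∀ s t → swapLine s t ≡ swapLine t s
swapLine-sym zero          zero          = refl
swapLine-sym zero          (suc zero)    = refl
swapLine-sym (suc zero)    zero          = refl
swapLine-sym (suc zero)    (suc zero)    = refl

swapLine-rowSum : ∀ s σ → ∑ (λ t → swapLine s t ⟨$⟩ σ) ≡ 1ℚ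
swapLine-rowSum zero = solve 1 (λ σ → (:- con 1ℚ :* σ :+ con 1ℚ) :+ ((con 1ℚ :* σ :+ con 0ℚ) :+ con 0ℚ)
                                      := con 1ℚ) refl
swapLine-rowSum (suc _) = solve 1 (λ σ → (con 1ℚ :* σ :+ con 0ℚ) :+ ((:- con 1ℚ :* σ :+ con 1ℚ) :+ con 0ℚ)
                                         := con 1ℚ) refl

swapLine-01 : ∀ s t {σ} → Is01 σ → Is01 (swapLine s t ⟨$⟩ σ)
swapLine-01 zero    zero    = complementLine-01
swapLine-01 zero    (suc _) = subst Is01 (sym (identityLine _))
swapLine-01 (suc _) zero    = subst Is01 (sym (identityLine _))
swapLine-01 (suc _) (suc _) = complementLine-01

doublyStochastic₂ : (M : Fin 2 → Fin 2 → ℚ) → (∀ s → ∑ (M s) ≡ 1ℚ) → (∀ t → ∑ (λ s → M s t) ≡ 1ℚ) →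
                    ∀ s t → M s t ≡ swapLine s t ⟨$⟩ M zero (suc zero)
doublyStochastic₂ M row col = entry
  where
  complementˡ : ∀ {p q} → p + (q + 0ℚ) ≡ 1ℚ → p ≡ - 1ℚ * q + 1ℚ
  complementˡ {p} {q} p+q≡1 =
    trans (solve 2 (λ p q → p := :- con 1ℚ :* q :+ (p :+ (q :+ con 0ℚ))) refl p q)
          (cong (- 1ℚ * q +_) p+q≡1)

  complementʳ : ∀ {p q} → p + (q + 0ℚ) ≡ 1ℚ → q ≡ - 1ℚ * p + 1ℚ
  complementʳ {p} {q} p+q≡1 =
    complementˡ {q} {p} (trans (solve 2 (λ p q → q :+ (p :+ con 0ℚ) := p :+ (q :+ con 0ℚ)) refl p q) p+q≡1)

  r : ℚ
  r = M zero (suc zero)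

  M₁₀≡r : M (suc zero) zero ≡ r
  M₁₀≡r = begin
    M (suc zero) zero        ≡⟨ complementʳ {M zero zero} {M (suc zero) zero} (col zero) ⟩
    - 1ℚ * M zero zero + 1ℚ  ≡⟨ cong (λ u → - 1ℚ * u + 1ℚ) (complementˡ {M zero zero} {r} (row zero)) ⟩
    - 1ℚ * (- 1ℚ * r + 1ℚ) + 1ℚ
      ≡⟨ solve 1 (λ r → :- con 1ℚ :* (:- con 1ℚ :* r :+ con 1ℚ) :+ con 1ℚ := r) refl r ⟩
    r                        ∎

  entry : ∀ s t → M s t ≡ swapLine s t ⟨$⟩ r
  entry zero       zero       = complementˡ {M zero zero} {r} (row zero)
  entry zero       (suc zero) = sym (identityLine r)
  entry (suc zero) zero       = trans M₁₀≡r (sym (identityLine r))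
  entry (suc zero) (suc zero) =
    trans (complementʳ {M (suc zero) zero} {M (suc zero) (suc zero)} (row (suc zero))) (cong (λ u → - 1ℚ * u + 1ℚ) M₁₀≡r)

-- Block-diagonal 2 × 2 permutation matrices, indexed by Fin 2 × Fin n

blockLine : ∀ {n} → Fin 2 × Fin n → Fin 2 × Fin n → Line
blockLine (s , b) (t , c) with b ≟ c
... | yes _ = swapLine s t
... | no  _ = 0ℚ , 0ℚ

blockLine-same : ∀ {n} s t (b : Fin n) → blockLine (s , b) (t , b) ≡ swapLine s t
blockLine-same s t b with b ≟ b
... | yes _   = refl
... | no b≢b = contradiction refl b≢b

blockLine-other : ∀ {n} (p q : Fin 2 × Fin n) → proj₂ p ≢ proj₂ q → blockLine p q ≡ (0ℚ , 0ℚ)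
blockLine-other (s , b) (t , c) b≢c with b ≟ c
... | yes b≡c = contradiction b≡c b≢c
... | no  _   = refl

blockLine-01 : ∀ {n} (p q : Fin 2 × Fin n) {σ} → Is01 σ → Is01 (blockLine p q ⟨$⟩ σ)
blockLine-01 (s , b) (t , c) {σ} σ∈01 with b ≟ c
... | yes _ = swapLine-01 s t σ∈01
... | no  _ = inj₁ (zeroLine σ)

-- The embedding of BQP_n onto a face of QAP_2n

module BlockEmbedding (n : ℕ) where

  m : ℕ
  m = 2 ℕ.* n

  at : Fin 2 → Fin n → Fin m
  at = combine

  split : Fin m → Fin 2 × Fin n
  split = remQuot {2} n

  block : Fin m → Fin n
  block = proj₂ ∘ split

  block-at : ∀ s b → block (at s b) ≡ b
  block-at s b = cong proj₂ (remQuot-combine s b)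

  block-at-≢ : ∀ {s t b c} → b ≢ c → block (at s b) ≢ block (at t c)
  block-at-≢ {s} {t} {b} {c} b≢c eq =
    b≢c (trans (sym (block-at s b)) (trans eq (block-at t c)))

  lineOf : Fin m → Fin m → Line
  lineOf i j = blockLine (split i) (split j)

  encode : QAPIdx m → Form (BQPIdx n)
  encode (inj₁ (i , j))                   = lineForm (lineOf i j) (diag (block i))
  encode (inj₂ (((i , j) , (k , l)) , _)) = productForm (lineOf i j) (block i) (lineOf k l) (block k)

  φ : Pt (BQPIdx n) → Pt (QAPIdx m)
  φ = evalMap encode

  Y : Pt (BQPIdx n) → Fin m → Fin m → ℚ
  Y x i j = lineOf i j ⟨$⟩ x (diag (block i))

  Y-at : ∀ x s b t c → Y x (at s b) (at t c) ≡ blockLine (s , b) (t , c) ⟨$⟩ x (diag b)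
  Y-at x s b t c =
    cong₂ (λ κ β → κ ⟨$⟩ x (diag β))
          (cong₂ blockLine (remQuot-combine s b) (remQuot-combine t c)) (block-at s b)

  Y-same : ∀ x s t b → Y x (at s b) (at t b) ≡ swapLine s t ⟨$⟩ x (diag b)
  Y-same x s t b = trans (Y-at x s b t b) (cong (_⟨$⟩ x (diag b)) (blockLine-same s t b))

  Y-other : ∀ x s t {b c} → b ≢ c → Y x (at s b) (at t c) ≡ 0ℚ
  Y-other x s t {b} {c} b≢c =
    trans (Y-at x s b t c)
          (trans (cong (_⟨$⟩ x (diag b)) (blockLine-other (s , b) (t , c) b≢c)) (zeroLine (x (diag b))))

  Y-offBlock : ∀ x i j → block i ≢ block j → Y x i j ≡ 0ℚ
  Y-offBlock x i j i≢j =
    trans (cong (_⟨$⟩ x (diag (block i))) (blockLine-other (split i) (split j) i≢j))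
          (zeroLine (x (diag (block i))))

  rowSum : ∀ x s b → ∑ (Y x (at s b)) ≡ 1ℚ
  rowSum x s b = begin
    ∑ (Y x (at s b))
      ≡⟨ ∑-combine-single {2} {n} _ b (λ t c c≢b → Y-other x s t (c≢b ∘ sym)) ⟩
    ∑ (λ t → Y x (at s b) (at t b))
      ≡⟨ ∑-cong (λ t → Y-same x s t b) ⟩
    ∑ (λ t → swapLine s t ⟨$⟩ x (diag b))
      ≡⟨ swapLine-rowSum s _ ⟩
    1ℚ ∎

  colSum : ∀ x t c → ∑ (λ i → Y x i (at t c)) ≡ 1ℚ
  colSum x t c = begin
    ∑ (λ i → Y x i (at t c))
      ≡⟨ ∑-combine-single {2} {n} _ c (λ s b b≢c → Y-other x s t b≢c) ⟩
    ∑ (λ s → Y x (at s c) (at t c))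
      ≡⟨ ∑-cong (λ s → trans (Y-same x s t c) (cong (_⟨$⟩ x (diag c)) (swapLine-sym s t))) ⟩
    ∑ (λ s → swapLine t s ⟨$⟩ x (diag c))
      ≡⟨ swapLine-rowSum t _ ⟩
    1ℚ ∎

  φ-vertex : ∀ {x} → BQPVert n x → QAPVert m (φ x)
  φ-vertex {x} x∈V@(x∈01 , _) =
    φx∈01 ,
    combine-elim (λ i → ∑ (Y x i) ≡ 1ℚ) (rowSum x) ,
    combine-elim (λ j → ∑ (λ i → Y x i j) ≡ 1ℚ) (colSum x) ,
    λ i j k l _ → eval-productForm x∈V (lineOf i j) (block i) (lineOf k l) (block k)
    where
    Y∈01 : ∀ i j → Is01 (Y x i j)
    Y∈01 i j = blockLine-01 (split i) (split j) (x∈01 (diag (block i)))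

    φx∈01 : ∀ c → Is01 (φ x c)
    φx∈01 (inj₁ (i , j)) = Y∈01 i j
    φx∈01 (inj₂ (((i , j) , (k , l)) , _)) =
      subst Is01 (sym (eval-productForm x∈V (lineOf i j) (block i) (lineOf k l) (block k)))
            (Is01-* (Y∈01 i j) (Y∈01 k l))

  pivot : Fin n → Fin m × Fin m
  pivot b = at zero b , at (suc zero) b

  pivot-line : ∀ b → (lineOf (at zero b) (at (suc zero) b) , block (at zero b))
                     ≡ ((1ℚ , 0ℚ) , b)
  pivot-line b =
    cong₂ _,_ (trans (cong₂ blockLine (remQuot-combine zero b) (remQuot-combine (suc zero) b))
                     (blockLine-same zero (suc zero) b))
              (block-at zero b)

  pivot-lex : ∀ {b b′} → toℕ b ℕ.< toℕ b′ → T (lexLt (pivot b) (pivot b′))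
  pivot-lex {b} {b′} b<b′ =
    Equivalence.from T-∨ (inj₁ (<⇒<ᵇ (subst₂ ℕ._<_ (sym (toℕ-↑ˡ b _)) (sym (toℕ-↑ˡ b′ _)) b<b′)))

  project : BQPIdx n → QAPIdx m
  project ((b , b′) , _) with toℕ b ℕ.<? toℕ b′
  ... | yes b<b′ = inj₂ ((pivot b , pivot b′) , pivot-lex b<b′)
  ... | no  _    = inj₁ (pivot b)

  ψ : Pt (QAPIdx m) → Pt (BQPIdx n)
  ψ v k = v (project k)

  ψ-preserves : PreservesAffineCombinations ψ
  ψ-preserves _ _ _ v≡ k = v≡ (project k)

  project-diag : ∀ b → project (diag b) ≡ inj₁ (pivot b)
  project-diag b with toℕ b ℕ.<? toℕ b
  ... | yes b<b = contradiction b<b (<-irrefl refl)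
  ... | no  _   = refl

  project-< : ∀ {b b′} (p : T (toℕ b ℕ.≤ᵇ toℕ b′)) (b<b′ : toℕ b ℕ.< toℕ b′) →
              project ((b , b′) , p) ≡ inj₂ ((pivot b , pivot b′) , pivot-lex b<b′)
  project-< {b} {b′} p b<b′ with toℕ b ℕ.<? toℕ b′
  ... | yes _    = cong (λ lt → inj₂ ((pivot b , pivot b′) , lt)) (T-irrelevant _ _)
  ... | no b≮b′ = contradiction b<b′ b≮b′

  ψφ≈id : ∀ x → ψ (φ x) ≈ x
  ψφ≈id x ((b , b′) , p) with toℕ b ℕ.<? toℕ b′
  ... | yes _ = begin
    eval x (productForm (lineOf (at zero b) (at (suc zero) b)) (block (at zero b))
                        (lineOf (at zero b′) (at (suc zero) b′)) (block (at zero b′)))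
      ≡⟨ cong₂ (λ u u′ → eval x (productForm (proj₁ u) (proj₂ u) (proj₁ u′) (proj₂ u′)))
               (pivot-line b) (pivot-line b′) ⟩
    eval x (productForm (1ℚ , 0ℚ) b (1ℚ , 0ℚ) b′)
      ≡⟨ eval-productForm-identity x b b′ ⟩
    x (pairIdx b b′)
      ≡⟨ cong x (pairIdx-≤ p) ⟩
    x ((b , b′) , p) ∎
  ... | no b≮b′ with toℕ-injective (ℕP.≤-antisym (≤ᵇ⇒≤ _ _ p) (≮⇒≥ b≮b′))
  ...   | refl = trans (Y-same x zero (suc zero) b)
                       (trans (identityLine _) (cong x (bqpIdx-irrelevant _ _)))

  ψ-vertex : ∀ {v} → QAPVert m v → BQPVert n (ψ v)
  ψ-vertex {v} (v∈01 , _ , _ , z≡yy) = v∈01 ∘ project , product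
    where
    product : ∀ (k : BQPIdx n) → toℕ (proj₁ (proj₁ k)) ℕ.< toℕ (proj₂ (proj₁ k)) →
              ψ v k ≡ ψ v (diag (proj₁ (proj₁ k))) * ψ v (diag (proj₂ (proj₁ k)))
    product ((b , b′) , p) b<b′ =
      trans (cong v (project-< p b<b′))
            (trans (z≡yy _ _ _ _ (pivot-lex b<b′))
                   (sym (cong₂ _*_ (cong v (project-diag b)) (cong v (project-diag b′)))))

  OffBlockZero : Pt (QAPIdx m) → Set
  OffBlockZero v = ∀ i j → block i ≢ block j → v (inj₁ (i , j)) ≡ 0ℚ

  φψ-vertex : ∀ {v} → QAPVert m v → OffBlockZero v → φ (ψ v) ≈ v
  φψ-vertex {v} v∈V@(_ , rows , cols , z≡yy) v-off = φψv≡v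
    where
    y : Fin m → Fin m → ℚ
    y i j = v (inj₁ (i , j))

    blockEntry : ∀ b s t → y (at s b) (at t b) ≡ swapLine s t ⟨$⟩ uncurry y (pivot b)
    blockEntry b = doublyStochastic₂ (λ s t → y (at s b) (at t b)) blockRow blockCol
      where
      blockRow : ∀ s → ∑ (λ t → y (at s b) (at t b)) ≡ 1ℚ
      blockRow s = trans (sym (∑-combine-single {2} {n} (y (at s b)) b
                                (λ t c c≢b → v-off (at s b) (at t c) (block-at-≢ {s} {t} (c≢b ∘ sym)))))
                         (rows (at s b))
      blockCol : ∀ t → ∑ (λ s → y (at s b) (at t b)) ≡ 1ℚ
      blockCol t = trans (sym (∑-combine-single {2} {n} (λ i → y i (at t b)) b
                                (λ s c c≢b → v-off (at s c) (at t b) (block-at-≢ {s} {t} c≢b))))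
                         (cols (at t b))

    Yψ-at : ∀ s b t c → Y (ψ v) (at s b) (at t c) ≡ y (at s b) (at t c)
    Yψ-at s b t c with b ≟ c
    ... | no b≢c  = trans (Y-other (ψ v) s t b≢c) (sym (v-off (at s b) (at t c) (block-at-≢ {s} {t} b≢c)))
    ... | yes refl = trans (Y-same (ψ v) s t b)
                           (trans (cong (λ u → swapLine s t ⟨$⟩ v u) (project-diag b))
                                  (sym (blockEntry b s t)))

    Yψ : ∀ i j → Y (ψ v) i j ≡ y i j
    Yψ = combine-elim (λ i → ∀ j → Y (ψ v) i j ≡ y i j)
           (λ s b → combine-elim (λ j → Y (ψ v) (at s b) j ≡ y (at s b) j) (Yψ-at s b))

    φψv≡v : ∀ c → φ (ψ v) c ≡ v c
    φψv≡v (inj₁ (i , j)) = Yψ i j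
    φψv≡v (inj₂ (((i , j) , (k , l)) , lt)) =
      trans (eval-productForm (ψ-vertex v∈V) (lineOf i j) (block i) (lineOf k l) (block k))
            (trans (cong₂ _*_ (Yψ i j) (Yψ k l)) (sym (z≡yy i j k l lt)))

  offBlockEntry : Pt (QAPIdx m) → Fin m → Fin m → ℚ
  offBlockEntry v i j with block i ≟ block j
  ... | yes _ = 0ℚ
  ... | no  _ = v (inj₁ (i , j))

  offBlockMass : Pt (QAPIdx m) → ℚ
  offBlockMass v = ∑ (λ i → ∑ (offBlockEntry v i))

  g : Pt (QAPIdx m) → ℚ
  g v = - offBlockMass v

  offBlockEntry-nonneg : ∀ {v} → (∀ c → 0ℚ ≤ v c) → ∀ i j → 0ℚ ≤ offBlockEntry v i j
  offBlockEntry-nonneg v≥0 i j with block i ≟ block j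
  ... | yes _ = ℚP.≤-refl
  ... | no  _ = v≥0 _

  offBlockEntry-≢ : ∀ v i j → block i ≢ block j → offBlockEntry v i j ≡ v (inj₁ (i , j))
  offBlockEntry-≢ v i j i≢j with block i ≟ block j
  ... | yes i≡j = contradiction i≡j i≢j
  ... | no  _   = refl

  g-affine : IsAffineFunctional g
  g-affine = record { g-cong = g-cong ; g-affine = affine }
    where
    entry-cong : ∀ {v v′} → v ≈ v′ → ∀ i j → offBlockEntry v i j ≡ offBlockEntry v′ i j
    entry-cong v≈v′ i j with block i ≟ block j
    ... | yes _ = refl
    ... | no  _ = v≈v′ _

    g-cong : ∀ {v v′} → v ≈ v′ → g v ≡ g v′
    g-cong v≈v′ = cong -_ (∑-cong (λ i → ∑-cong (entry-cong v≈v′ i)))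

    entry-comb : ∀ t v v′ i j → offBlockEntry (comb t v v′) i j
                                ≡ t * offBlockEntry v i j + (1ℚ - t) * offBlockEntry v′ i j
    entry-comb t v v′ i j with block i ≟ block j
    ... | yes _ = solve 1 (λ t → con 0ℚ := t :* con 0ℚ :+ (con 1ℚ :- t) :* con 0ℚ) refl t
    ... | no  _ = refl

    affine : ∀ t v v′ → g (comb t v v′) ≡ t * g v + (1ℚ - t) * g v′
    affine t v v′ =
      trans (cong -_ (trans (∑-cong (λ i → trans (∑-cong (entry-comb t v v′ i)) (∑-comb {m} t _ _)))
                            (∑-comb {m} t _ _)))
            (solve 3 (λ t a b → :- (t :* a :+ (con 1ℚ :- t) :* b)
                                := t :* (:- a) :+ (con 1ℚ :- t) :* (:- b))
                   refl t (offBlockMass v) (offBlockMass v′))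

  g≤0 : ∀ v → QAP m v → g v ≤ 0ℚ
  g≤0 v v∈Q =
    ℚP.neg-antimono-≤ (∑-nonneg (λ i → ∑-nonneg (offBlockEntry-nonneg (conv-01-nonneg {S = QAPVert m} proj₁ v∈Q) i)))

  BlockFace : Region (QAPIdx m)
  BlockFace v = QAP m v × (g v ≡ 0ℚ)

  blockFace-offBlockZero : ∀ {v} → BlockFace v → OffBlockZero v
  blockFace-offBlockZero {v} (v∈Q , gv≡0) i j i≢j =
    trans (sym (offBlockEntry-≢ v i j i≢j))
          (∑-nonneg-zero (offBlockEntry-nonneg v≥0 i)
                         (∑-nonneg-zero (λ i → ∑-nonneg (offBlockEntry-nonneg v≥0 i))
                                        (ℚP.neg-injective {q = 0ℚ} gv≡0) i) j)
    where
    v≥0 : ∀ c → 0ℚ ≤ v c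
    v≥0 = conv-01-nonneg {S = QAPVert m} proj₁ v∈Q

  φ-blockFace : ∀ {x} → BQP n x → BlockFace (φ x)
  φ-blockFace {x} x∈P =
    conv-image (evalMap-preserves encode) {S′ = QAPVert m} φ-vertex x∈P ,
    cong -_ (trans (∑-cong (λ i → trans (∑-cong (entry≡0 i)) (∑-zero m))) (∑-zero m))
    where
    entry≡0 : ∀ i j → offBlockEntry (φ x) i j ≡ 0ℚ
    entry≡0 i j with block i ≟ block j
    ... | yes _   = refl
    ... | no i≢j = Y-offBlock x i j i≢j

  φψ-blockFace : ∀ {v} → BlockFace v → φ (ψ v) ≈ v
  φψ-blockFace v∈F@((_ , p , w , p∈V , w≥0 , ∑w≡1 , v≡) , _) =
    fixes-combination (∘-preserves (evalMap-preserves encode) ψ-preserves) p w ∑w≡1 v≡ supported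
    where
    -- a vertex with positive weight in a point of the face lies in the face
    supported : ∀ a → w a ≢ 0ℚ → φ (ψ (p a)) ≈ p a
    supported a wa≢0 = φψ-vertex (p∈V a) λ i j i≢j →
      Is01-*-cancelˡ wa≢0 (proj₁ (p∈V a) _)
        (∑-nonneg-zero (λ b → Is01-nonneg-* (w≥0 b) (proj₁ (p∈V b) _))
                       (trans (sym (v≡ _)) (blockFace-offBlockZero v∈F i j i≢j)) a)

  blockFace-isFace : IsFace BlockFace (QAP m)
  blockFace-isFace = face-of-valid-inequality g-affine g≤0

  equivalence : AffinelyEquivalent (BQP n) BlockFace
  equivalence =
    mkAffinelyEquivalent (evalMap-preserves encode) ψ-preserves φ-blockFace
      (λ v∈F → conv-image ψ-preserves {S = QAPVert m} {S′ = BQPVert n} ψ-vertex (proj₁ v∈F))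
      ψφ≈id φψ-blockFace

-- The construction needs no lower bound on n.
theorem11 : (n : ℕ) → 1 ℕ.≤ n → BQP n ≤A QAP (2 ℕ.* n)
theorem11 n _ = inj₂ (BlockFace , blockFace-isFace , equivalence)
  where open BlockEmbedding n
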